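{- Let $(W,S)$ be a Coxeter system and $B$ a Garside shadow in $(W,S)$. Let $w\in W$ and $s\in S$ with $s\notin D_L(w)$. Then $\pi_B(sw)=\pi_B(s\pi_B(w))$.
   Context: $\ell$ is the length function; $D_L(w)=\{s\in S\mid \ell(sw)<\ell(w)\}$. $u$ is a prefix of $w$ if $\ell(w)=\ell(u)+\ell(u^{ -1}w)$; $v$ is a suffix of $w$ if $\ell(w)=\ell(wv^{ -1})+\ell(v)$. The right weak order is $u\le_R w$ iff $u$ is a prefix of $w$; every bounded subset has a join $\bigvee$. A Garside shadow is $B\subseteq W$ with $S\subseteq B$, closed under joins of bounded subsets and under taking suffixes. $\pi_B(w)=\bigvee\{g\in B\mid g\le_R w\}$. -}

module Defs where

open import Data.Nat using (ℕ; zero; suc; _+_; _*_; _<_; _≤_)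
open import Data.Fin using (Fin)
open import Data.List using (List; []; _∷_; _++_; length; reverse; [_])
open import Data.Maybe using (Maybe; just; nothing)
open import Data.Product using (Σ; ∃; ∃-syntax; _×_; _,_)
open import Data.Sum using (_⊎_)
open import Relation.Binary.PropositionalEquality using (_≡_; _≢_)

-- A Coxeter matrix on the finite generating set S = Fin n.
-- m s t = nothing encodes m(s,t) = ∞ (no relation).
record CoxeterMatrix (n : ℕ) : Set where
  field
    m     : Fin n → Fin n → Maybe ℕ
    diag  : ∀ s → m s s ≡ just 1
    sym   : ∀ s t → m s t ≡ m t s
    off   : ∀ s t → s ≢ t → (∃[ k ] m s t ≡ just (suc (suc k))) ⊎ (m s t ≡ nothing)

Word : ℕ → Set
Word n = List (Fin n)

alt : ∀ {n} → Fin n → Fin n → ℕ → Word n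
alt s t zero    = []
alt s t (suc k) = s ∷ alt t s k

module Coxeter {n : ℕ} (M : CoxeterMatrix n) where
  open CoxeterMatrix M

  data BaseRel : Word n → Word n → Set where
    invol : ∀ s → BaseRel (s ∷ s ∷ []) []
    braid : ∀ s t k → m s t ≡ just k → BaseRel (alt s t (2 * k)) []

  -- W = (List S)/≈ is the Coxeter group of M (generators are involutions,
  -- so the monoid presentation equals the group presentation).
  infix 4 _≈_
  data _≈_ : Word n → Word n → Set where
    ≈-refl  : ∀ {u} → u ≈ u
    ≈-sym   : ∀ {u v} → u ≈ v → v ≈ u
    ≈-trans : ∀ {u v w} → u ≈ v → v ≈ w → u ≈ w
    ≈-rel   : ∀ u v {l r} → BaseRel l r → (u ++ l ++ v) ≈ (u ++ r ++ v)

  -- Group structure on representatives: product = concatenation,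
  -- inverse = reversal (generators are involutions), generator s = [ s ].
  inv : Word n → Word n
  inv = reverse

  HasLength : Word n → ℕ → Set
  HasLength w k = (∃[ v ] (v ≈ w × length v ≡ k)) × (∀ v → v ≈ w → k ≤ length v)

  _≤R_ : Word n → Word n → Set
  u ≤R w = ∃[ a ] ∃[ b ] ∃[ c ]
    (HasLength u a × HasLength (inv u ++ w) b × HasLength w c × c ≡ a + b)

  IsSuffix : Word n → Word n → Set
  IsSuffix v w = ∃[ a ] ∃[ b ] ∃[ c ]
    (HasLength (w ++ inv v) a × HasLength v b × HasLength w c × c ≡ a + b)

  InDL : Fin n → Word n → Set
  InDL s w = ∃[ a ] ∃[ b ] (HasLength (s ∷ w) a × HasLength w b × a < b)

  UpperBound : (Word n → Set) → Word n → Set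
  UpperBound X u = ∀ x → X x → x ≤R u

  Bounded : (Word n → Set) → Set
  Bounded X = ∃[ u ] UpperBound X u

  IsJoin : (Word n → Set) → Word n → Set
  IsJoin X p = UpperBound X p × (∀ u → UpperBound X u → p ≤R u)

  record GarsideShadow (B : Word n → Set) : Set₁ where
    field
      respects : ∀ u v → u ≈ v → B u → B v      -- B is a subset of W
      gens     : ∀ s → B [ s ]
      joins    : ∀ (X : Word n → Set) → (∀ x → X x → B x) → Bounded X →
                 ∀ p → IsJoin X p → B p
      suffixes : ∀ g v → B g → IsSuffix v g → B v

  -- { g ∈ B | g ≤_R w };  π_B(w) is its join.
  BelowIn : (Word n → Set) → Word n → Word n → Set
  BelowIn B w g = B g × g ≤R w

  IsProj : (Word n → Set) → Word n → Word n → Set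
  IsProj B w p = IsJoin (BelowIn B w) p

-- Since s is not a left descent of w, the length parity of words (the sign character of W)
-- forces ℓ(sw) = ℓ(w) + 1, so s ≤R sw. Put p = π_B(w) and q = π_B(sw). As s ∈ B we get
-- s ≤R q, so sq is a suffix of q ∈ B and cancelling s from q ≤R sw gives sq ≤R w; hence
-- sq ≤R p and q ≤R sp. Conversely p ≤R w lifts to sp ≤R sw, so every g ∈ B below sp lies
-- below sw and therefore below q: q is the join of the elements of B below sp.
module Submission where

open import Defs
open import Data.Nat using (ℕ; zero; suc; parity; _+_; _*_; _≤_; z≤n; s≤s)
open import Data.Nat.Properties using (+-assoc; +-cancelˡ-≤; +-cancelʳ-≤; ≤-antisym; ≤∧≢⇒<; ≮⇒≥)
open import Data.Parity.Base as ℙ using (Parity)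
open import Data.Parity.Properties using (+-homo-+; *-homo-*; suc-homo-⁻¹; p≢p⁻¹)
open import Data.Fin using (Fin)
open import Data.List using ([]; _∷_; _++_; length; reverse; [_])
open import Data.List.Properties
  using (++-assoc; ++-identityʳ; length-++; unfold-reverse; reverse-++; reverse-involutive)
open import Data.Product using (∃; _×_; _,_; proj₁; proj₂)
open import Relation.Nullary using (¬_; contradiction)
open import Relation.Binary.Bundles using (Setoid)
open import Relation.Binary.PropositionalEquality
  using (_≡_; _≢_; refl; sym; trans; cong; subst)
import Relation.Binary.Reasoning.Setoid as SetoidReasoning

length-alt : ∀ {n} (s t : Fin n) k → length (alt s t k) ≡ k
length-alt s t zero    = refl
length-alt s t (suc k) = cong suc (length-alt t s k)

module CoxeterLength {n : ℕ} (M : CoxeterMatrix n) where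
  open Coxeter M

  ≈-setoid : Setoid _ _
  ≈-setoid = record
    { Carrier       = Word n
    ; _≈_           = _≈_
    ; isEquivalence = record { refl = ≈-refl ; sym = ≈-sym ; trans = ≈-trans }
    }

  open SetoidReasoning ≈-setoid

  ≈-reflexive : ∀ {u v} → u ≡ v → u ≈ v
  ≈-reflexive refl = ≈-refl

  ++-congˡ : ∀ x {u v} → u ≈ v → x ++ u ≈ x ++ v
  ++-congˡ x ≈-refl          = ≈-refl
  ++-congˡ x (≈-sym h)       = ≈-sym (++-congˡ x h)
  ++-congˡ x (≈-trans h h′)  = ≈-trans (++-congˡ x h) (++-congˡ x h′)
  ++-congˡ x (≈-rel u v {l} {r} b) = begin
    x ++ (u ++ l ++ v)  ≡⟨ ++-assoc x u (l ++ v) ⟨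
    (x ++ u) ++ l ++ v  ≈⟨ ≈-rel (x ++ u) v b ⟩
    (x ++ u) ++ r ++ v  ≡⟨ ++-assoc x u (r ++ v) ⟩
    x ++ (u ++ r ++ v)  ∎

  ++-congʳ : ∀ x {u v} → u ≈ v → u ++ x ≈ v ++ x
  ++-congʳ x ≈-refl          = ≈-refl
  ++-congʳ x (≈-sym h)       = ≈-sym (++-congʳ x h)
  ++-congʳ x (≈-trans h h′)  = ≈-trans (++-congʳ x h) (++-congʳ x h′)
  ++-congʳ x (≈-rel u v {l} {r} b) = begin
    (u ++ l ++ v) ++ x  ≡⟨ assoc₃ l ⟩
    u ++ l ++ (v ++ x)  ≈⟨ ≈-rel u (v ++ x) b ⟩
    u ++ r ++ (v ++ x)  ≡⟨ assoc₃ r ⟨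
    (u ++ r ++ v) ++ x  ∎
    where
    assoc₃ : ∀ y → (u ++ y ++ v) ++ x ≡ u ++ y ++ (v ++ x)
    assoc₃ y = trans (++-assoc u (y ++ v) x) (cong (u ++_) (++-assoc y v x))

  ++-cong : ∀ {u u′ v v′} → u ≈ u′ → v ≈ v′ → u ++ v ≈ u′ ++ v′
  ++-cong {u′ = u′} {v} h h′ = ≈-trans (++-congʳ v h) (++-congˡ u′ h′)

  generator-involutive : ∀ s w → s ∷ s ∷ w ≈ w
  generator-involutive s w = ≈-rel [] w (invol s)

  inverseʳ : ∀ x → x ++ inv x ≈ []
  inverseʳ []      = ≈-refl
  inverseʳ (a ∷ x) = begin
    a ∷ x ++ reverse (a ∷ x)    ≡⟨ cong (λ r → a ∷ x ++ r) (unfold-reverse a x) ⟩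
    a ∷ x ++ (reverse x ++ [ a ]) ≡⟨ cong (a ∷_) (++-assoc x (reverse x) [ a ]) ⟨
    a ∷ (x ++ reverse x) ++ [ a ] ≈⟨ ++-congˡ [ a ] (++-congʳ [ a ] (inverseʳ x)) ⟩
    a ∷ a ∷ []                    ≈⟨ generator-involutive a [] ⟩
    []                            ∎

  inverseˡ : ∀ x → inv x ++ x ≈ []
  inverseˡ x = subst (λ y → inv x ++ y ≈ []) (reverse-involutive x) (inverseʳ (inv x))

  x++x⁻¹++z≈z : ∀ x z → x ++ (inv x ++ z) ≈ z
  x++x⁻¹++z≈z x z = ≈-trans (≈-reflexive (sym (++-assoc x (inv x) z))) (++-congʳ z (inverseʳ x))

  x⁻¹++x++z≈z : ∀ x z → inv x ++ (x ++ z) ≈ z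
  x⁻¹++x++z≈z x z = ≈-trans (≈-reflexive (sym (++-assoc (inv x) x z))) (++-congʳ z (inverseˡ x))

  inv-++ : ∀ x y z → inv (x ++ y) ++ z ≡ inv y ++ (inv x ++ z)
  inv-++ x y z = trans (cong (_++ z) (reverse-++ x y)) (++-assoc (inv y) (inv x) z)

  inv-cong : ∀ {u v} → u ≈ v → inv u ≈ inv v
  inv-cong {u} {v} h = begin
    inv u                   ≡⟨ ++-identityʳ (inv u) ⟨
    inv u ++ []             ≈⟨ ++-congˡ (inv u) (inverseʳ v) ⟨
    inv u ++ (v ++ inv v)   ≈⟨ ++-congˡ (inv u) (++-congʳ (inv v) h) ⟨
    inv u ++ (u ++ inv v)   ≈⟨ x⁻¹++x++z≈z u (inv v) ⟩
    inv v                   ∎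

  wordParity : Word n → Parity
  wordParity w = parity (length w)

  wordParity-++ : ∀ x y → wordParity (x ++ y) ≡ wordParity x ℙ.+ wordParity y
  wordParity-++ x y = trans (cong parity (length-++ x)) (+-homo-+ (length x) (length y))

  BaseRel-wordParity : ∀ {l r} → BaseRel l r → wordParity l ≡ wordParity r
  BaseRel-wordParity (invol s)        = refl
  BaseRel-wordParity (braid s t k _)  = trans (cong parity (length-alt s t (2 * k))) (*-homo-* 2 k)

  ≈-wordParity : ∀ {u v} → u ≈ v → wordParity u ≡ wordParity v
  ≈-wordParity ≈-refl          = refl
  ≈-wordParity (≈-sym h)       = sym (≈-wordParity h)
  ≈-wordParity (≈-trans h h′)  = trans (≈-wordParity h) (≈-wordParity h′)
  ≈-wordParity (≈-rel u v {l} {r} b) =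
    trans (split l)
      (trans (cong (λ π → wordParity u ℙ.+ (π ℙ.+ wordParity v)) (BaseRel-wordParity b))
        (sym (split r)))
    where
    split : ∀ y → wordParity (u ++ y ++ v) ≡ wordParity u ℙ.+ (wordParity y ℙ.+ wordParity v)
    split y = trans (wordParity-++ u (y ++ v)) (cong (wordParity u ℙ.+_) (wordParity-++ y v))

  HasWordOfLength : Word n → ℕ → Set
  HasWordOfLength u k = ∃ λ r → r ≈ u × length r ≡ k

  HasWordOfLength-cong : ∀ {u v k} → HasWordOfLength u k → u ≈ v → HasWordOfLength v k
  HasWordOfLength-cong (r , r≈u , len) u≈v = r , ≈-trans r≈u u≈v , len

  HasWordOfLength-++ : ∀ {x y a b} →
    HasWordOfLength x a → HasWordOfLength y b → HasWordOfLength (x ++ y) (a + b)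
  HasWordOfLength-++ (r , r≈x , refl) (r′ , r′≈y , refl) = r ++ r′ , ++-cong r≈x r′≈y , length-++ r

  HasLength-cong : ∀ {u v k} → HasLength u k → u ≈ v → HasLength v k
  HasLength-cong (word , minimal) u≈v =
    HasWordOfLength-cong word u≈v , λ r r≈v → minimal r (≈-trans r≈v (≈-sym u≈v))

  HasLength-minimal : ∀ {u c k} → HasLength u c → HasWordOfLength u k → c ≤ k
  HasLength-minimal (_ , minimal) (r , r≈u , refl) = minimal r r≈u

  HasLength-unique : ∀ {u a b} → HasLength u a → HasLength u b → a ≡ b
  HasLength-unique ℓu ℓu′ = ≤-antisym (HasLength-minimal ℓu (proj₁ ℓu′)) (HasLength-minimal ℓu′ (proj₁ ℓu))

  HasLength-wordParity : ∀ {u k} → HasLength u k → parity k ≡ wordParity u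
  HasLength-wordParity ((r , r≈u , refl) , _) = ≈-wordParity r≈u

  HasLength-generator : ∀ s → HasLength [ s ] 1
  HasLength-generator s = ([ s ] , ≈-refl , refl) , minimal
    where
    minimal : ∀ r → r ≈ [ s ] → 1 ≤ length r
    minimal []      []≈s = contradiction (≈-wordParity []≈s) λ ()
    minimal (_ ∷ _) _    = s≤s z≤n

  HasLength-subadditive : ∀ {x y z a b c} → HasLength x a → HasLength y b → HasLength z c →
    x ++ y ≈ z → c ≤ a + b
  HasLength-subadditive ℓx ℓy ℓz xy≈z =
    HasLength-minimal ℓz (HasWordOfLength-cong (HasWordOfLength-++ (proj₁ ℓx) (proj₁ ℓy)) xy≈z)

  HasLength-rightFactor : ∀ {x y z a b} → HasLength x a → HasLength z (a + b) →
    x ++ y ≈ z → HasWordOfLength y b → HasLength y b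
  HasLength-rightFactor {a = a} {b} ℓx ℓz xy≈z word = word , minimal
    where
    minimal : ∀ r → r ≈ _ → b ≤ length r
    minimal r r≈y = +-cancelˡ-≤ a b (length r) (HasLength-minimal ℓz
      (HasWordOfLength-cong (HasWordOfLength-++ (proj₁ ℓx) (r , r≈y , refl)) xy≈z))

  HasLength-leftFactor : ∀ {x y z a b} → HasLength y b → HasLength z (a + b) →
    x ++ y ≈ z → HasWordOfLength x a → HasLength x a
  HasLength-leftFactor {a = a} {b} ℓy ℓz xy≈z word = word , minimal
    where
    minimal : ∀ r → r ≈ _ → a ≤ length r
    minimal r r≈x = +-cancelʳ-≤ b a (length r) (HasLength-minimal ℓz
      (HasWordOfLength-cong (HasWordOfLength-++ (r , r≈x , refl) (proj₁ ℓy)) xy≈z))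

  HasLength-quotient : ∀ {x y z a b d} → HasLength x a →
    HasLength (inv x ++ y) b → HasLength (inv y ++ z) d → HasLength z (a + (b + d)) →
    HasLength (inv x ++ z) (b + d)
  HasLength-quotient {x} {y} {z} ℓx ℓx⁻¹y ℓy⁻¹z ℓz =
    HasLength-rightFactor ℓx ℓz (x++x⁻¹++z≈z x z)
      (HasWordOfLength-cong (HasWordOfLength-++ (proj₁ ℓx⁻¹y) (proj₁ ℓy⁻¹z)) x⁻¹y·y⁻¹z≈x⁻¹z)
    where
    x⁻¹y·y⁻¹z≈x⁻¹z : (inv x ++ y) ++ (inv y ++ z) ≈ inv x ++ z
    x⁻¹y·y⁻¹z≈x⁻¹z = ≈-trans (≈-reflexive (++-assoc (inv x) y (inv y ++ z)))
                              (++-congˡ (inv x) (x++x⁻¹++z≈z y z))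

  ℓ-ascent : ∀ {s w c e} → ¬ InDL s w → HasLength w c → HasLength (s ∷ w) e → e ≡ suc c
  ℓ-ascent {s} {w} {c} {e} s∉DL ℓw ℓsw = ≤-antisym e≤1+c (≤∧≢⇒< c≤e c≢e)
    where
    e≤1+c : e ≤ suc c
    e≤1+c = HasLength-subadditive (HasLength-generator s) ℓw ℓsw ≈-refl
    c≤e : c ≤ e
    c≤e = ≮⇒≥ λ e<c → s∉DL (e , c , ℓsw , ℓw , e<c)
    c≢e : c ≢ e
    c≢e refl = p≢p⁻¹ _ (trans (trans (sym (HasLength-wordParity ℓsw)) (HasLength-wordParity ℓw))
                               (sym (suc-homo-⁻¹ (length w))))

  ≤R-intro : ∀ {u w a b} → HasLength u a → HasLength (inv u ++ w) b → HasLength w (a + b) → u ≤R w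
  ≤R-intro ℓu ℓu⁻¹w ℓw = _ , _ , _ , ℓu , ℓu⁻¹w , ℓw , refl

  ≤R-lengthʳ : ∀ {u w} → u ≤R w → ∃ (HasLength w)
  ≤R-lengthʳ (_ , _ , c , _ , _ , ℓw , _) = c , ℓw

  ≤R-respˡ : ∀ {u u′ w} → u ≈ u′ → u ≤R w → u′ ≤R w
  ≤R-respˡ {w = w} u≈u′ (a , b , c , ℓu , ℓu⁻¹w , ℓw , eq) =
    a , b , c , HasLength-cong ℓu u≈u′ , HasLength-cong ℓu⁻¹w (++-congʳ w (inv-cong u≈u′)) , ℓw , eq

  ≤R-respʳ : ∀ {u w w′} → u ≤R w → w ≈ w′ → u ≤R w′
  ≤R-respʳ {u} (a , b , c , ℓu , ℓu⁻¹w , ℓw , eq) w≈w′ =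
    a , b , c , ℓu , HasLength-cong ℓu⁻¹w (++-congˡ (inv u) w≈w′) , HasLength-cong ℓw w≈w′ , eq

  ≤R-trans : ∀ {x y z} → x ≤R y → y ≤R z → x ≤R z
  ≤R-trans (a , b , _ , ℓx , ℓx⁻¹y , ℓy , refl) (_ , d , _ , ℓy′ , ℓy⁻¹z , ℓz , refl)
    with refl ← HasLength-unique ℓy′ ℓy =
    let ℓz′ = subst (HasLength _) (+-assoc a b d) ℓz
    in ≤R-intro ℓx (HasLength-quotient ℓx ℓx⁻¹y ℓy⁻¹z ℓz′) ℓz′

  ≤R-cancelˡ : ∀ {x v z} → x ≤R v → v ≤R z → (inv x ++ v) ≤R (inv x ++ z)
  ≤R-cancelˡ {x} {v} {z} (a , b , _ , ℓx , ℓx⁻¹v , ℓv , refl) (_ , d , _ , ℓv′ , ℓv⁻¹z , ℓz , refl)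
    with refl ← HasLength-unique ℓv′ ℓv =
    ≤R-intro ℓx⁻¹v (HasLength-cong ℓv⁻¹z (≈-sym [x⁻¹v]⁻¹x⁻¹z≈v⁻¹z))
      (HasLength-quotient ℓx ℓx⁻¹v ℓv⁻¹z (subst (HasLength z) (+-assoc a b d) ℓz))
    where
    [x⁻¹v]⁻¹x⁻¹z≈v⁻¹z : inv (inv x ++ v) ++ (inv x ++ z) ≈ inv v ++ z
    [x⁻¹v]⁻¹x⁻¹z≈v⁻¹z = begin
      inv (inv x ++ v) ++ (inv x ++ z)       ≡⟨ inv-++ (inv x) v (inv x ++ z) ⟩
      inv v ++ (inv (inv x) ++ (inv x ++ z)) ≡⟨ cong (λ y → inv v ++ (y ++ (inv x ++ z))) (reverse-involutive x) ⟩
      inv v ++ (x ++ (inv x ++ z))           ≈⟨ ++-congˡ (inv v) (x++x⁻¹++z≈z x z) ⟩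
      inv v ++ z                             ∎

  ≤R-++ : ∀ {x y z} → x ≤R z → y ≤R (inv x ++ z) → x ≤R (x ++ y) × (x ++ y) ≤R z
  ≤R-++ {x} {y} {z} (a , b , _ , ℓx , ℓx⁻¹z , ℓz , refl) (b′ , d , _ , ℓy , ℓy⁻¹x⁻¹z , ℓx⁻¹z′ , refl)
    with refl ← HasLength-unique ℓx⁻¹z′ ℓx⁻¹z =
    ≤R-intro ℓx (HasLength-cong ℓy (≈-sym (x⁻¹++x++z≈z x y))) ℓxy ,
    ≤R-intro ℓxy ℓ[xy]⁻¹z ℓz′
    where
    ℓz′ : HasLength z (a + b′ + d)
    ℓz′ = subst (HasLength z) (sym (+-assoc a b′ d)) ℓz
    ℓ[xy]⁻¹z : HasLength (inv (x ++ y) ++ z) d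
    ℓ[xy]⁻¹z = subst (λ u → HasLength u d) (sym (inv-++ x y z)) ℓy⁻¹x⁻¹z
    ℓxy : HasLength (x ++ y) (a + b′)
    ℓxy = HasLength-leftFactor ℓ[xy]⁻¹z ℓz′ (x++x⁻¹++z≈z (x ++ y) z)
            (HasWordOfLength-++ (proj₁ ℓx) (proj₁ ℓy))

  ascent⇒generator-≤R : ∀ {s w c e} → ¬ InDL s w → HasLength w c → HasLength (s ∷ w) e →
    [ s ] ≤R (s ∷ w)
  ascent⇒generator-≤R {s} {w} s∉DL ℓw ℓsw =
    ≤R-intro (HasLength-generator s) (HasLength-cong ℓw (≈-sym (generator-involutive s w)))
      (subst (HasLength (s ∷ w)) (ℓ-ascent s∉DL ℓw ℓsw) ℓsw)

  ≤R⇒IsSuffix : ∀ {u w} → u ≤R w → IsSuffix (inv u ++ w) w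
  ≤R⇒IsSuffix {u} {w} (a , b , c , ℓu , ℓu⁻¹w , ℓw , eq) =
    a , b , c , HasLength-cong ℓu (≈-sym w[u⁻¹w]⁻¹≈u) , ℓu⁻¹w , ℓw , eq
    where
    w[u⁻¹w]⁻¹≈u : w ++ inv (inv u ++ w) ≈ u
    w[u⁻¹w]⁻¹≈u = begin
      w ++ inv (inv u ++ w)         ≡⟨ cong (w ++_) (reverse-++ (inv u) w) ⟩
      w ++ (inv w ++ inv (inv u))   ≡⟨ cong (λ y → w ++ (inv w ++ y)) (reverse-involutive u) ⟩
      w ++ (inv w ++ u)             ≈⟨ x++x⁻¹++z≈z w u ⟩
      u                             ∎

  IsProj⇒≤R : ∀ {B w p} → IsProj B w p → p ≤R w
  IsProj⇒≤R {w = w} (_ , least) = least w λ _ → proj₂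

  IsProj⇒∈ : ∀ {B w p} → GarsideShadow B → IsProj B w p → B p
  IsProj⇒∈ {B} {w} {p} shadow π[w] =
    GarsideShadow.joins shadow (BelowIn B w) (λ _ → proj₁) (w , λ _ → proj₂) p π[w]

proposition2p8 : (n : ℕ) (M : CoxeterMatrix n) (B : Word n → Set) →
    Coxeter.GarsideShadow M B →
    (w : Word n) (s : Fin n) → ¬ Coxeter.InDL M s w →
    (p q : Word n) → Coxeter.IsProj M B w p → Coxeter.IsProj M B (s ∷ w) q →
    Coxeter.IsProj M B (s ∷ p) q
proposition2p8 n M B shadow w s s∉DL p q π[w] π[sw] = upper , least
  where
  open Coxeter M
  open CoxeterLength M
  open GarsideShadow shadow

  p≤w = IsProj⇒≤R π[w]
  q≤sw = IsProj⇒≤R π[sw]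
  q∈B = IsProj⇒∈ shadow π[sw]

  s≤sw : [ s ] ≤R (s ∷ w)
  s≤sw = ascent⇒generator-≤R s∉DL (proj₂ (≤R-lengthʳ p≤w)) (proj₂ (≤R-lengthʳ q≤sw))

  s≤q : [ s ] ≤R q
  s≤q = proj₁ π[sw] [ s ] (gens s , s≤sw)

  sq≤p : (s ∷ q) ≤R p
  sq≤p = proj₁ π[w] (s ∷ q)
    (suffixes q (s ∷ q) q∈B (≤R⇒IsSuffix s≤q) , ≤R-respʳ (≤R-cancelˡ s≤q q≤sw) (generator-involutive s w))

  s≤sp×sp≤sw : [ s ] ≤R (s ∷ p) × (s ∷ p) ≤R (s ∷ w)
  s≤sp×sp≤sw = ≤R-++ s≤sw (≤R-respʳ p≤w (≈-sym (generator-involutive s w)))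

  s≤sp = proj₁ s≤sp×sp≤sw
  sp≤sw = proj₂ s≤sp×sp≤sw

  q≤sp : q ≤R (s ∷ p)
  q≤sp = ≤R-respˡ (generator-involutive s q)
    (proj₂ (≤R-++ s≤sp (≤R-respʳ sq≤p (≈-sym (generator-involutive s p)))))

  upper : UpperBound (BelowIn B (s ∷ p)) q
  upper g (g∈B , g≤sp) = proj₁ π[sw] g (g∈B , ≤R-trans g≤sp sp≤sw)

  least : ∀ u → UpperBound (BelowIn B (s ∷ p)) u → q ≤R u
  least u u-upper = u-upper q (q∈B , q≤sp)
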